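{- Let $G$ be a finite connected graph in which every half-edge is labeled with exactly one label from $\{\mathsf{U},\mathsf{D},\mathsf{L},\mathsf{R}\}$ such that the following constraints hold at every node $u$: (a) any two edges $e,e'$ incident to $u$ have $L_u(e)\neq L_u(e')$; (b) for each edge $e=\{u,v\}$, $L_u(e)=\mathsf{L}$ iff $L_v(e)=\mathsf{R}$ (if $L_u(e)=\mathsf L$ then $L_v(e)=\mathsf R$ and vice versa); (c) for each edge $e=\{u,v\}$, if $L_u(e)=\mathsf{U}$ then $L_v(e)=\mathsf{D}$ and vice versa; (d) if $u$ has two incident edges labeled $\mathsf{R}$ and $\mathsf{U}$ respectively, then $f_u(\mathsf{R},\mathsf{U},\mathsf{L},\mathsf{D})=u$; (e) if $f_u(\mathsf{R})$ exists, then $u$ has an incident edge labeled $\mathsf{D}$ (resp. $\mathsf{U}$) iff $f_u(\mathsf{R})$ has an incident edge labeled $\mathsf{D}$ (resp. $\mathsf{U}$); (f) if $f_u(\mathsf{U})$ exists, then $u$ has an incident edge labeled $\mathsf{L}$ (resp. $\mathsf{R}$) iff $f_u(\mathsf{U})$ has an incident edge labeled $\mathsf{L}$ (resp. $\mathsf{R}$). Assume moreover that there exists at least one node that has no incident half-edge labeled $\mathsf{D}$ (or $\mathsf{U}$), and at least one node that has no incident half-edge labeled $\mathsf{L}$ (or $\mathsf{R}$). Then $G$ is a grid structure.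
   Context: $L_u(e)$ denotes the label of the half-edge $(u,e)$. For a node $u$ and labels $L_1,\dots,L_k$, $f_u(L_1,\dots,L_k)$ is defined as follows: consider the walk $u=v_1,v_2,\dots,v_{k+1}$ where for each $i$, $v_{i+1}$ is reached from $v_i$ via an edge $e_i=\{v_i,v_{i+1}\}$ with $L_{v_i}(e_i)=L_i$; if this walk exists and is unique, $f_u(L_1,\dots,L_k)=v_{k+1}$, otherwise $f_u(L_1,\dots,L_k)=\bot$ ("exists" means $\neq\bot$). A graph $G$ is a grid structure of size $h\times w$ if its nodes can be assigned coordinates $(x_u,y_u)$ bijectively onto $\{0,\dots,w-1\}\times\{0,\dots,h-1\}$ such that for nodes $u,v$ with $x_v\le x_u$, $y_v\le y_u$, there is an edge $\{u,v\}$ iff $(x_u,y_u)=(x_v+1,y_v)$ or $(x_u,y_u)=(x_v,y_v+1)$. -}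

module Defs where

open import Data.Nat using (ℕ; suc; _≤_)
open import Data.Fin using (Fin; toℕ)
open import Data.Maybe using (Maybe; just; nothing)
open import Data.List using (List; []; _∷_)
open import Data.Product using (Σ; ∃; _×_; _,_; proj₁; proj₂)
open import Data.Sum using (_⊎_)
open import Relation.Binary.PropositionalEquality using (_≡_; _≢_)
open import Relation.Nullary using (¬_)
open import Function.Bundles using (_⇔_; Bijection; _⤖_)

data Label : Set where
  U D L R : Label

-- A finite simple graph on nodes Fin n together with a half-edge labeling is
-- encoded by  lab : Fin n → Fin n → Maybe Label  where
--   lab u v ≡ just l   iff  {u,v} is an edge and  L_u({u,v}) = l,
--   lab u v ≡ nothing  iff  {u,v} is not an edge.
-- (Thus every half-edge carries exactly one label.)
HalfLab : ℕ → Set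
HalfLab n = Fin n → Fin n → Maybe Label

module _ {n : ℕ} (lab : HalfLab n) where

  IsSimpleGraph : Set
  IsSimpleGraph =
    (∀ u → lab u u ≡ nothing) ×
    (∀ u v → lab u v ≡ nothing → lab v u ≡ nothing)

  Adj : Fin n → Fin n → Set
  Adj u v = ∃ λ l → lab u v ≡ just l

  data Reach : Fin n → Fin n → Set where
    here  : ∀ {u} → Reach u u
    there : ∀ {u v w} → Adj u v → Reach v w → Reach u w

  Connected : Set
  Connected = ∀ u v → Reach u v

  HasLabel : Fin n → Label → Set
  HasLabel u l = ∃ λ v → lab u v ≡ just l

  data Walk : Fin n → List Label → Fin n → Set where
    []   : ∀ {u} → Walk u [] u
    step : ∀ {u v w l ls} → lab u v ≡ just l → Walk v ls w → Walk u (l ∷ ls) w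

  nodes : ∀ {u ls w} → Walk u ls w → List (Fin n)
  nodes {u} []         = u ∷ []
  nodes {u} (step _ p) = u ∷ nodes p

  -- f_u(ls) = w : a walk exists, ends in w, and it is the unique walk
  -- (any two walks from u with labels ls have the same node sequence)
  FIs : Fin n → List Label → Fin n → Set
  FIs u ls w = Walk u ls w ×
    (∀ {a b} (p : Walk u ls a) (q : Walk u ls b) → nodes p ≡ nodes q)

  FExists : Fin n → List Label → Set
  FExists u ls = ∃ λ w → FIs u ls w

  ConstrA : Set
  ConstrA = ∀ u v v' l → lab u v ≡ just l → lab u v' ≡ just l → v ≡ v'

  ConstrB : Set
  ConstrB = ∀ u v → (lab u v ≡ just L) ⇔ (lab v u ≡ just R)

  ConstrC : Set
  ConstrC = ∀ u v → (lab u v ≡ just U) ⇔ (lab v u ≡ just D)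

  ConstrD : Set
  ConstrD = ∀ u → HasLabel u R → HasLabel u U → FIs u (R ∷ U ∷ L ∷ D ∷ []) u

  ConstrE : Set
  ConstrE = ∀ u w → FIs u (R ∷ []) w →
    (HasLabel u D ⇔ HasLabel w D) × (HasLabel u U ⇔ HasLabel w U)

  ConstrF : Set
  ConstrF = ∀ u w → FIs u (U ∷ []) w →
    (HasLabel u L ⇔ HasLabel w L) × (HasLabel u R ⇔ HasLabel w R)

  IsGridStructure : ℕ → ℕ → Set
  IsGridStructure h w = Σ (Fin n ⤖ (Fin w × Fin h)) λ c →
    let x : Fin n → ℕ
        x u = toℕ (proj₁ (Bijection.to c u))
        y : Fin n → ℕ
        y u = toℕ (proj₂ (Bijection.to c u))
    in ∀ u v → x v ≤ x u → y v ≤ y u →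
       Adj u v ⇔ ((x u ≡ suc (x v) × y u ≡ y v) ⊎ (x u ≡ x v × y u ≡ suc (y v)))

  IsGrid : Set
  IsGrid = ∃ λ h → ∃ λ w → IsGridStructure h w

-- Call a node a corner if it has no L- and no D-edge. Constraints (d)–(f) say
-- that an R-edge and a U-edge (or a D-edge) always close up into a unit
-- square, so the node reached from a corner o by i R-steps followed by j
-- U-steps does not depend on the order of the steps; this gives coordinates
-- (i , j), bounded by the lengths of the maximal R- and U-paths out of o, and
-- every neighbour of a coordinatised node is coordinatised by the adjacent
-- cell, so connectivity makes the coordinates a bijection. A corner exists:
-- following D-edges from a node without L must end (a D-cycle would spread to
-- every node along the squares, contradicting the node without D), and its
-- end is a corner since (f) transports the absence of L along D-edges.
module Submission where

open import Defs
open import Data.Nat using (ℕ; zero; suc; _≤_; _<_; z≤n; s≤s)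
open import Data.Nat.Properties using (≤-antisym; n<1+n; <-irrefl)
open import Data.Fin using (Fin; toℕ; fromℕ<)
open import Data.Fin.Properties using (toℕ-fromℕ<; toℕ-injective; pigeonhole; any?)
open import Data.Maybe using (just)
open import Data.Maybe.Properties using (≡-dec)
open import Data.List using ([]; _∷_)
open import Data.Product using (∃; ∃₂; _×_; _,_; proj₁; proj₂)
open import Data.Sum using (_⊎_; inj₁; inj₂)
open import Data.Empty using (⊥-elim)
open import Relation.Nullary using (¬_; Dec; yes; no)
open import Relation.Binary.Definitions using (DecidableEquality)
open import Relation.Binary.PropositionalEquality using (_≡_; refl; sym; cong; cong₂; subst; subst₂)
open import Function.Bundles using (Equivalence; mk⇔; mk⤖)
open import Function.Consequences.Propositional using (strictlySurjective⇒surjective)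

data Path {A : Set} (Rl : A → A → Set) : ℕ → A → A → Set where
  []  : ∀ {x} → Path Rl 0 x x
  _∷_ : ∀ {k x y z} → Rl x y → Path Rl k y z → Path Rl (suc k) x z

module _ {A : Set} (Rl : A → A → Set) where

  DeadEnd : A → Set
  DeadEnd x = ¬ ∃ (Rl x)

  MaximalPath : A → Set
  MaximalPath x = ∃₂ λ k e → Path Rl k x e × DeadEnd e

  OnCycle : A → Set
  OnCycle x = ∃ λ k → Path Rl (suc k) x x

  Functional : Set
  Functional = ∀ {x y y'} → Rl x y → Rl x y' → y ≡ y'

  Injective : Set
  Injective = ∀ {x x' y} → Rl x y → Rl x' y → x ≡ x'

module _ {A : Set} {Rl : A → A → Set} where

  _∷ʳ_ : ∀ {k x y z} → Path Rl k x y → Rl y z → Path Rl (suc k) x z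
  [] ∷ʳ r       = r ∷ []
  (r' ∷ p) ∷ʳ r = r' ∷ (p ∷ʳ r)

  unsnoc : ∀ {k x z} → Path Rl (suc k) x z → ∃ λ y → Path Rl k x y × Rl y z
  unsnoc (r ∷ []) = _ , [] , r
  unsnoc (r ∷ p@(_ ∷ _)) with y , p' , r' ← unsnoc p = y , r ∷ p' , r'

  prefix : ∀ {k x z} (i : Fin (suc k)) → Path Rl k x z → ∃ (Path Rl (toℕ i) x)
  prefix Fin.zero    p       = _ , []
  prefix (Fin.suc i) (r ∷ p) with m , q ← prefix i p = m , r ∷ q

  Path-functional : Functional Rl → ∀ {k x a b} → Path Rl k x a → Path Rl k x b → a ≡ b
  Path-functional f []       []         = refl
  Path-functional f (r ∷ p) (r' ∷ q) with refl ← f r r' = Path-functional f p q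

  length-≤-maximal : Functional Rl → ∀ {j j' x a a'} →
                     Path Rl j x a → Path Rl j' x a' → DeadEnd Rl a' → j ≤ j'
  length-≤-maximal f []       _          _   = z≤n
  length-≤-maximal f (r ∷ p) []         end = ⊥-elim (end (_ , r))
  length-≤-maximal f (r ∷ p) (r' ∷ q) end with refl ← f r r' = s≤s (length-≤-maximal f p q end)

  maximal-length-unique : Functional Rl → ∀ {j j' x a a'} → Path Rl j x a → Path Rl j' x a' →
                          DeadEnd Rl a → DeadEnd Rl a' → j ≡ j'
  maximal-length-unique f p q end end' =
    ≤-antisym (length-≤-maximal f p q end') (length-≤-maximal f q p end)

  Path-preserves : {P : A → Set} → (∀ {x y} → Rl x y → P x → P y) →
                   ∀ {k x y} → Path Rl k x y → P x → P y
  Path-preserves h []       px = px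
  Path-preserves h (r ∷ p) px = Path-preserves h p (h r px)

  Path-reflects : {P : A → Set} → (∀ {x y} → Rl x y → P y → P x) →
                  ∀ {k x y} → Path Rl k x y → P y → P x
  Path-reflects h []       py = py
  Path-reflects h (r ∷ p) py = h r (Path-reflects h p py)

  cycle-has-predecessor : ∀ {x} → OnCycle Rl x → ∃ λ m → Rl m x
  cycle-has-predecessor (_ , cyc) with m , _ , r ← unsnoc cyc = m , r

  -- Injectivity lets both paths be cut back from the common end until the
  -- shorter one is empty.
  revisit⇒cycle : Injective Rl → ∀ {i j x m} → Path Rl i x m → Path Rl j x m → i < j →
                  OnCycle Rl x
  revisit⇒cycle inj []      q (s≤s _) = _ , q
  revisit⇒cycle inj {suc i} {suc (suc j)} p q (s≤s (s≤s i<j))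
    with m , p' , r ← unsnoc p | m' , q' , r' ← unsnoc q
    with refl ← inj r r' = revisit⇒cycle inj p' q' (s≤s i<j)

reverse : ∀ {A : Set} {Rl Rl' : A → A → Set} → (∀ {x y} → Rl x y → Rl' y x) →
          ∀ {k x y} → Path Rl k x y → Path Rl' k y x
reverse f []       = []
reverse f (r ∷ p) = reverse f p ∷ʳ f r

module _ {A : Set} (P Q : A → A → Set) where

  Diamond : Set
  Diamond = ∀ {x y x'} → P x y → Q x x' → ∃ λ y' → Q y y' × P x' y'

  Commute : Set
  Commute = ∀ {x y y'} → P x y → Q y y' → ∃ λ x' → Q x x' × P x' y'

module _ {A : Set} {P Q : A → A → Set} where

  diamond-path : Diamond P Q → ∀ {j x y x'} → P x y → Path Q j x x' →
                 ∃ λ y' → Path Q j y y' × P x' y'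
  diamond-path sq pr []       = _ , [] , pr
  diamond-path sq pr (q ∷ qs)
    with _ , q' , pr' ← sq pr q
    with y' , qs' , pr'' ← diamond-path sq pr' qs = y' , q' ∷ qs' , pr''

  diamond-paths : Diamond P Q → ∀ {i j x a c} → Path P i x a → Path Q j x c →
                  ∃ λ v → Path Q j a v × Path P i c v
  diamond-paths sq []       qs = _ , qs , []
  diamond-paths sq (p ∷ ps) qs
    with _ , qs' , pc ← diamond-path sq p qs
    with v , qa , pcv ← diamond-paths sq ps qs' = v , qa , pc ∷ pcv

  commute-path : Commute P Q → ∀ {j x y y'} → P x y → Path Q j y y' →
                 ∃ λ x' → Path Q j x x' × P x' y'
  commute-path sq pr []       = _ , [] , pr
  commute-path sq pr (q ∷ qs)
    with _ , q' , pr' ← sq pr q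
    with x' , qs' , pr'' ← commute-path sq pr' qs = x' , q' ∷ qs' , pr''

  commute-paths : Commute P Q → ∀ {i j x a v} → Path P i x a → Path Q j a v →
                  ∃ λ c → Path Q j x c × Path P i c v
  commute-paths sq []       qs = _ , qs , []
  commute-paths sq (p ∷ ps) qs
    with _ , qc' , pc'v ← commute-paths sq ps qs
    with c , qc , pcc' ← commute-path sq p qc' = c , qc , pcc' ∷ pc'v

module _ {n : ℕ} {Rl : Fin n → Fin n → Set} (successor? : ∀ x → Dec (∃ (Rl x))) where

  path-or-maximal : ∀ m x → ∃ (Path Rl m x) ⊎ MaximalPath Rl x
  path-or-maximal zero    x = inj₁ (_ , [])
  path-or-maximal (suc m) x with successor? x
  ... | no end = inj₂ (0 , x , [] , end)
  ... | yes (y , r) with path-or-maximal m y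
  ...   | inj₁ (c , p)            = inj₁ (c , r ∷ p)
  ...   | inj₂ (k , e , p , end) = inj₂ (suc k , e , r ∷ p , end)

  module _ (inj : Injective Rl) where

    long-path⇒cycle : ∀ {x c} → Path Rl n x c → OnCycle Rl x
    long-path⇒cycle {x} p
      with i , j , i<j , same ← pigeonhole (n<1+n n) (λ i → proj₁ (prefix i p)) =
      revisit⇒cycle inj (proj₂ (prefix i p))
        (subst (Path Rl (toℕ j) x) (sym same) (proj₂ (prefix j p))) i<j

    maximal-or-cycle : ∀ x → MaximalPath Rl x ⊎ OnCycle Rl x
    maximal-or-cycle x with path-or-maximal n x
    ... | inj₁ (_ , p) = inj₂ (long-path⇒cycle p)
    ... | inj₂ m       = inj₁ m

    unpreceded⇒maximal : ∀ {x} → ¬ (∃ λ m → Rl m x) → MaximalPath Rl x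
    unpreceded⇒maximal {x} unpreceded with maximal-or-cycle x
    ... | inj₁ m   = m
    ... | inj₂ cyc = ⊥-elim (unpreceded (cycle-has-predecessor cyc))

_≟_ : DecidableEquality Label
U ≟ U = yes refl
U ≟ D = no λ ()
U ≟ L = no λ ()
U ≟ R = no λ ()
D ≟ U = no λ ()
D ≟ D = yes refl
D ≟ L = no λ ()
D ≟ R = no λ ()
L ≟ U = no λ ()
L ≟ D = no λ ()
L ≟ L = yes refl
L ≟ R = no λ ()
R ≟ U = no λ ()
R ≟ D = no λ ()
R ≟ L = no λ ()
R ≟ R = yes refl

opposite : Label → Label
opposite U = D
opposite D = U
opposite L = R
opposite R = L

module Labelling {n : ℕ} (lab : HalfLab n) (connected : Connected lab)
  (cA : ConstrA lab) (cB : ConstrB lab) (cC : ConstrC lab)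
  (cD : ConstrD lab) (cE : ConstrE lab) (cF : ConstrF lab) where

  Edge : Label → Fin n → Fin n → Set
  Edge l u v = lab u v ≡ just l

  Edge-functional : ∀ l → Functional (Edge l)
  Edge-functional l = cA _ _ _ l

  Edge-reverse : ∀ l {x y} → Edge l x y → Edge (opposite l) y x
  Edge-reverse U {x} {y} = Equivalence.to (cC x y)
  Edge-reverse D {x} {y} = Equivalence.from (cC y x)
  Edge-reverse L {x} {y} = Equivalence.to (cB x y)
  Edge-reverse R {x} {y} = Equivalence.from (cB y x)

  Edge-injective : ∀ l → Injective (Edge l)
  Edge-injective l e e' = Edge-functional (opposite l) (Edge-reverse l e) (Edge-reverse l e')

  Path-reverse : ∀ l {k x y} → Path (Edge l) k x y → Path (Edge (opposite l)) k y x
  Path-reverse l = reverse (Edge-reverse l)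

  successor? : ∀ l x → Dec (∃ (Edge l x))
  successor? l x = any? (λ v → ≡-dec _≟_ (lab x v) (just l))

  walks-agree : ∀ {u ls a b} (p : Walk lab u ls a) (q : Walk lab u ls b) → nodes lab p ≡ nodes lab q
  walks-agree []         []         = refl
  walks-agree {u} (step e p) (step e' q) with refl ← cA _ _ _ _ e e' = cong (u ∷_) (walks-agree p q)

  edge⇒f : ∀ {l u w} → Edge l u w → FIs lab u (l ∷ []) w
  edge⇒f e = step e [] , walks-agree

  -- The walk R U L D back to x provided by (d) is the required square.
  RU-diamond : Diamond (Edge R) (Edge U)
  RU-diamond {x} r u
    with step r' (step u' (step l' (step d' []))) , _ ← cD x (_ , r) (_ , u)
    with refl ← Edge-functional R r r'
       | refl ← Edge-functional U u (Edge-reverse D d') = _ , u' , Edge-reverse L l'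

  RU-commute : Commute (Edge R) (Edge U)
  RU-commute {x} {y} r u
    with x' , ux ← Equivalence.from (proj₂ (cE x y (edge⇒f r))) (_ , u)
    with _ , u' , r' ← RU-diamond r ux
    with refl ← Edge-functional U u' u = x' , ux , r'

  RD-diamond : Diamond (Edge R) (Edge D)
  RD-diamond {x} {y} {x'} r d
    with y' , r' ← Equivalence.from (proj₂ (cF x' x (edge⇒f (Edge-reverse D d)))) (_ , r)
    with _ , u , r'' ← RU-diamond r' (Edge-reverse D d)
    with refl ← Edge-functional R r'' r = y' , Edge-reverse U u , r'

  RD-commute : Commute (Edge R) (Edge D)
  RD-commute {x} {y} r d
    with x' , dx ← Equivalence.from (proj₁ (cE x y (edge⇒f r))) (_ , d)
    with _ , d' , r' ← RD-diamond r dx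
    with refl ← Edge-functional D d' d = x' , dx , r'

  D-cycle-spreads : ∀ {x y} → Adj lab x y → OnCycle (Edge D) x → OnCycle (Edge D) y
  D-cycle-spreads (D , e) (k , d ∷ p) with refl ← Edge-functional D d e = k , p ∷ʳ e
  D-cycle-spreads (U , e) (k , cyc)
    with _ , p , d ← unsnoc cyc
    with refl ← Edge-injective D d (Edge-reverse U e) = k , Edge-reverse U e ∷ p
  D-cycle-spreads (R , e) (k , cyc)
    with _ , cyc' , r ← diamond-path RD-diamond e cyc
    with refl ← Edge-functional R r e = k , cyc'
  D-cycle-spreads (L , e) (k , cyc)
    with _ , cyc' , r ← commute-path RD-commute (Edge-reverse L e) cyc
    with refl ← Edge-injective R r (Edge-reverse L e) = k , cyc'

  no-opposite⇒maximal : ∀ l {x} → DeadEnd (Edge (opposite l)) x → MaximalPath (Edge l) x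
  no-opposite⇒maximal l noOpp =
    unpreceded⇒maximal (successor? l) (Edge-injective l) (λ (m , e) → noOpp (m , Edge-reverse l e))

  dead-end-exists : ∀ l → ∃ (DeadEnd (Edge l)) ⊎ ∃ (DeadEnd (Edge (opposite l))) →
                    ∃ (DeadEnd (Edge l))
  dead-end-exists l (inj₁ e)           = e
  dead-end-exists l (inj₂ (_ , noOpp)) with _ , e , _ , end ← no-opposite⇒maximal l noOpp = e , end

  R-preserves-no-D : ∀ {x y} → Edge R x y → DeadEnd (Edge D) x → DeadEnd (Edge D) y
  R-preserves-no-D {x} {y} r noD hasD = noD (Equivalence.from (proj₁ (cE x y (edge⇒f r))) hasD)

  U-reflects-L : ∀ {x y} → Edge U x y → ∃ (Edge L y) → ∃ (Edge L x)
  U-reflects-L {x} {y} u = Equivalence.from (proj₁ (cF x y (edge⇒f u)))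

  U-reflects-R : ∀ {x y} → Edge U x y → ∃ (Edge R y) → ∃ (Edge R x)
  U-reflects-R {x} {y} u = Equivalence.from (proj₂ (cF x y (edge⇒f u)))

  D-preserves-no-L : ∀ {x y} → Edge D x y → DeadEnd (Edge L) x → DeadEnd (Edge L) y
  D-preserves-no-L {x} {y} d noL hasL =
    noL (Equivalence.to (proj₁ (cF y x (edge⇒f (Edge-reverse D d)))) hasL)

  Reach-preserves : {P : Fin n → Set} → (∀ {x y} → Adj lab x y → P x → P y) →
                    ∀ {x y} → Reach lab x y → P x → P y
  Reach-preserves h here        px = px
  Reach-preserves h (there a r) px = Reach-preserves h r (h a px)

  corner-exists : ∃ (DeadEnd (Edge D)) → ∃ (DeadEnd (Edge L)) →
                  ∃ λ o → DeadEnd (Edge L) o × DeadEnd (Edge D) o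
  corner-exists (b , noD) (c , noL) with maximal-or-cycle (successor? D) (Edge-injective D) c
  ... | inj₁ (_ , e , p , end) = e , Path-preserves D-preserves-no-L p noL , end
  ... | inj₂ cyc with _ , d ∷ _ ← Reach-preserves D-cycle-spreads (connected c b) cyc =
    ⊥-elim (noD (_ , d))

  module Coordinates (o : Fin n) (noL : DeadEnd (Edge L) o) (noD : DeadEnd (Edge D) o)
    {kR : ℕ} {eR : Fin n} (row : Path (Edge R) kR o eR) (row-end : DeadEnd (Edge R) eR)
    {kU : ℕ} {eU : Fin n} (column : Path (Edge U) kU o eU) (column-end : DeadEnd (Edge U) eU) where

    At : ℕ → ℕ → Fin n → Set
    At i j v = ∃ λ a → Path (Edge R) i o a × Path (Edge U) j a v

    at-column-first : ∀ {i j v} → At i j v → ∃ λ c → Path (Edge U) j o c × Path (Edge R) i c v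
    at-column-first (_ , ra , ua) = commute-paths RU-commute ra ua

    at-functional : ∀ {i j v v'} → At i j v → At i j v' → v ≡ v'
    at-functional (_ , ra , ua) (_ , ra' , ua')
      with refl ← Path-functional (Edge-functional R) ra ra' = Path-functional (Edge-functional U) ua ua'

    at-unique : ∀ {i j i' j' v} → At i j v → At i' j' v → i ≡ i' × j ≡ j'
    at-unique (_ , ra , ua) (_ , ra' , ua')
      with refl ← maximal-length-unique (Edge-functional D) (Path-reverse U ua) (Path-reverse U ua')
                    (Path-preserves R-preserves-no-D ra noD) (Path-preserves R-preserves-no-D ra' noD)
      with refl ← Path-functional (Edge-functional D) (Path-reverse U ua) (Path-reverse U ua') =
      maximal-length-unique (Edge-functional L) (Path-reverse R ra) (Path-reverse R ra') noL noL , refl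

    at-bounded : ∀ {i j v} → At i j v → i ≤ kR × j ≤ kU
    at-bounded p@(_ , ra , _) with _ , uc , _ ← at-column-first p =
      length-≤-maximal (Edge-functional R) ra row row-end ,
      length-≤-maximal (Edge-functional U) uc column column-end

    at-exists : (i : Fin (suc kR)) (j : Fin (suc kU)) → ∃ (At (toℕ i) (toℕ j))
    at-exists i j
      with a , ra ← prefix i row
      with _ , uc ← prefix j column
      with v , av , _ ← diamond-paths RU-diamond ra uc = v , a , ra , av

    at-up : ∀ {i j v v'} → At i j v → Edge U v v' → At i (suc j) v'
    at-up (a , ra , ua) u = a , ra , ua ∷ʳ u

    at-right : ∀ {i j v v'} → At i j v → Edge R v v' → At (suc i) j v'
    at-right (a , ra , ua) r
      with a' , r' ← Path-reflects U-reflects-R ua (_ , r)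
      with _ , ua' , r'' ← diamond-path RU-diamond r' ua
      with refl ← Edge-functional R r'' r = a' , ra ∷ʳ r' , ua'

    at-left : ∀ {i j v v'} → At i j v → Edge L v v' → ∃ λ i' → i ≡ suc i' × At i' j v'
    at-left {zero} (_ , [] , ua) l = ⊥-elim (noL (Path-reflects U-reflects-L ua (_ , l)))
    at-left {suc i} (_ , ra , ua) l
      with m , rm , r ← unsnoc ra
      with _ , um , r' ← commute-path RU-commute r ua
      with refl ← Edge-functional L (Edge-reverse R r') l = i , refl , m , rm , um

    at-down : ∀ {i j v v'} → At i j v → Edge D v v' → ∃ λ j' → j ≡ suc j' × At i j' v'
    at-down {j = zero}  (_ , ra , []) d = ⊥-elim (Path-preserves R-preserves-no-D ra noD (_ , d))
    at-down {j = suc j} (a , ra , ua) d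
      with m , um , u ← unsnoc ua
      with refl ← Edge-functional D (Edge-reverse U u) d = j , refl , a , ra , um

    Located : Fin n → Set
    Located v = ∃₂ λ i j → At i j v

    adjacent-located : ∀ {v v'} → Adj lab v v' → Located v → Located v'
    adjacent-located (U , e) (_ , _ , p) = _ , _ , at-up p e
    adjacent-located (R , e) (_ , _ , p) = _ , _ , at-right p e
    adjacent-located (L , e) (_ , _ , p) with _ , _ , q ← at-left p e = _ , _ , q
    adjacent-located (D , e) (_ , _ , p) with _ , _ , q ← at-down p e = _ , _ , q

    width height : ℕ
    width  = suc kR
    height = suc kU

    AtCell : Fin width × Fin height → Fin n → Set
    AtCell (i , j) = At (toℕ i) (toℕ j)

    cell : ∀ v → ∃ λ c → AtCell c v
    cell v
      with i , j , p ← Reach-preserves adjacent-located (connected o v) (0 , 0 , o , [] , [])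
      with i≤kR , j≤kU ← at-bounded p =
      (fromℕ< (s≤s i≤kR) , fromℕ< (s≤s j≤kU)) ,
      subst₂ (λ i j → At i j v)
        (sym (toℕ-fromℕ< (s≤s i≤kR))) (sym (toℕ-fromℕ< (s≤s j≤kU))) p

    coordinates : Fin n → Fin width × Fin height
    coordinates v = proj₁ (cell v)

    at-coordinates : ∀ v → AtCell (coordinates v) v
    at-coordinates v = proj₂ (cell v)

    coordinates-injective : ∀ {u v} → coordinates u ≡ coordinates v → u ≡ v
    coordinates-injective {u} eq =
      at-functional (subst (λ c → AtCell c u) eq (at-coordinates u)) (at-coordinates _)

    coordinates-surjective : ∀ c → ∃ λ v → coordinates v ≡ c
    coordinates-surjective (i , j)
      with v , p ← at-exists i j
      with i≡ , j≡ ← at-unique (at-coordinates v) p =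
      v , cong₂ _,_ (toℕ-injective i≡) (toℕ-injective j≡)

    Neighbour : ℕ → ℕ → ℕ → ℕ → Set
    Neighbour xu yu xv yv = (xu ≡ suc xv × yu ≡ yv) ⊎ (xu ≡ xv × yu ≡ suc yv)

    adjacent⇒neighbour : ∀ {xu yu xv yv u v} → At xu yu u → At xv yv v → xv ≤ xu → yv ≤ yu →
                         Adj lab u v → Neighbour xu yu xv yv
    adjacent⇒neighbour pu pv _ _ (L , e)
      with _ , refl , q ← at-left pu e
      with refl , refl ← at-unique q pv = inj₁ (refl , refl)
    adjacent⇒neighbour pu pv _ _ (D , e)
      with _ , refl , q ← at-down pu e
      with refl , refl ← at-unique q pv = inj₂ (refl , refl)
    adjacent⇒neighbour pu pv xv≤xu _ (R , e)
      with refl , _ ← at-unique (at-right pu e) pv = ⊥-elim (<-irrefl refl xv≤xu)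
    adjacent⇒neighbour pu pv _ yv≤yu (U , e)
      with _ , refl ← at-unique (at-up pu e) pv = ⊥-elim (<-irrefl refl yv≤yu)

    neighbour⇒adjacent : ∀ {xu yu xv yv u v} → At xu yu u → At xv yv v →
                         Neighbour xu yu xv yv → Adj lab u v
    neighbour⇒adjacent pu pv (inj₁ (refl , refl))
      with _ , uc , rcu ← at-column-first pu | _ , uc' , rc'v ← at-column-first pv
      with refl ← Path-functional (Edge-functional U) uc uc'
      with _ , rcm , r ← unsnoc rcu
      with refl ← Path-functional (Edge-functional R) rcm rc'v = L , Edge-reverse R r
    neighbour⇒adjacent (_ , ra , ua) (_ , ra' , ua') (inj₂ (refl , refl))
      with refl ← Path-functional (Edge-functional R) ra ra'
      with _ , uam , u ← unsnoc ua
      with refl ← Path-functional (Edge-functional U) uam ua' = D , Edge-reverse U u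

    isGrid : IsGrid lab
    isGrid = height , width ,
      mk⤖ (coordinates-injective , strictlySurjective⇒surjective coordinates-surjective) ,
      λ u v xv≤xu yv≤yu →
        mk⇔ (adjacent⇒neighbour (at-coordinates u) (at-coordinates v) xv≤xu yv≤yu)
            (neighbour⇒adjacent (at-coordinates u) (at-coordinates v))

lemma6p5 : ∀ {n : ℕ} (lab : HalfLab n) →
    IsSimpleGraph lab → Connected lab →
    ConstrA lab → ConstrB lab → ConstrC lab →
    ConstrD lab → ConstrE lab → ConstrF lab →
    ((∃ λ u → ¬ HasLabel lab u D) ⊎ (∃ λ u → ¬ HasLabel lab u U)) →
    ((∃ λ u → ¬ HasLabel lab u L) ⊎ (∃ λ u → ¬ HasLabel lab u R)) →
    IsGrid lab
lemma6p5 lab _ connected cA cB cC cD cE cF someNoD someNoL =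
  let open Labelling lab connected cA cB cC cD cE cF
      (o , noL , noD)               = corner-exists (dead-end-exists D someNoD) (dead-end-exists L someNoL)
      (_ , _ , row , row-end)       = no-opposite⇒maximal R noL
      (_ , _ , column , column-end) = no-opposite⇒maximal U noD
  in Coordinates.isGrid o noL noD row row-end column column-end
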